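{- Let $S$ be a packing sequence and let $u$ be a leaf (vertex of degree $1$) of a graph $G$. Then $\chi_S(G)-1\le \chi_S(G-u)\le \chi_S(G)$.
   Context: A packing sequence is a non-decreasing sequence $S=(s_1,s_2,\ldots)$ of positive integers other than the constant sequence $(1,1,\ldots)$. An $S$-packing $k$-coloring of a graph $G$ is a map $c:V(G)\to\{1,\ldots,k\}$ such that whenever $u\neq v$ and $c(u)=c(v)=\ell$, the shortest-path distance satisfies $d_G(u,v)>s_\ell$. The $S$-packing chromatic number $\chi_S(G)$ is the least $k$ such that $G$ admits an $S$-packing $k$-coloring. -}

module Defs where

open import Data.Nat using (ℕ; zero; suc; _≤_; _+_)
open import Data.Fin using (Fin; toℕ; punchIn)
open import Data.Product using (Σ; _×_; ∃)
open import Relation.Binary.PropositionalEquality using (_≡_; _≢_)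
open import Relation.Nullary using (¬_)

record Graph (n : ℕ) : Set₁ where
  field
    Adj     : Fin n → Fin n → Set
    sym     : ∀ {u v} → Adj u v → Adj v u
    irrefl  : ∀ {u} → ¬ Adj u u
open Graph public

-- A packing sequence, 0-indexed: s_(i+1) is written S i.
record PackingSequence : Set where
  field
    s            : ℕ → ℕ
    positive     : ∀ i → 1 ≤ s i
    nondecr      : ∀ i j → i ≤ j → s i ≤ s j
    notAllOnes   : ∃ λ i → s i ≢ 1
open PackingSequence public

data Walk {n : ℕ} (G : Graph n) : Fin n → Fin n → ℕ → Set where
  nil  : ∀ {u} → Walk G u u 0
  cons : ∀ {u v w k} → Adj G u v → Walk G v w k → Walk G u w (suc k)

-- d_G(u,v) > d : no walk (equivalently no path) from u to v of length ≤ d.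
DistGt : ∀ {n} → Graph n → Fin n → Fin n → ℕ → Set
DistGt G u v d = ∀ k → k ≤ d → ¬ Walk G u v k

-- An S-packing k-colouring; colour c : Fin k stands for colour toℕ c + 1,
-- whose bound is s_(toℕ c + 1) = s S (toℕ c).
IsPackingColoring : ∀ {n} → PackingSequence → Graph n → (k : ℕ) → (Fin n → Fin k) → Set
IsPackingColoring S G k c =
  ∀ u v → u ≢ v → c u ≡ c v → DistGt G u v (s S (toℕ (c u)))

HasPackingColoring : ∀ {n} → PackingSequence → Graph n → ℕ → Set
HasPackingColoring {n} S G k = Σ (Fin n → Fin k) (IsPackingColoring S G k)

IsPackingChromaticNumber : ∀ {n} → PackingSequence → Graph n → ℕ → Set
IsPackingChromaticNumber S G k =
  HasPackingColoring S G k × (∀ m → HasPackingColoring S G m → k ≤ m)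

IsLeaf : ∀ {n} → Graph n → Fin n → Set
IsLeaf G u = ∃ λ v → Adj G u v × (∀ w → Adj G u w → w ≡ v)

deleteVertex : ∀ {n} → Graph (suc n) → Fin (suc n) → Graph n
deleteVertex G u = record
  { Adj    = λ i j → Adj G (punchIn u i) (punchIn u j)
  ; sym    = sym G
  ; irrefl = irrefl G
  }

-- A walk of G between two vertices other than the leaf u that enters u must leave it
-- straight back to the vertex it came from, so cutting out that detour gives a no longer
-- walk in G - u.  Hence G and G - u have the same distances away from u: an S-packing
-- colouring of G - u extended by one fresh colour on u is an S-packing colouring of G,
-- and an S-packing colouring of G restricts to one of G - u.
module Submission where

open import Defs
open import Data.Nat using (ℕ; suc; _≤_; _+_; s≤s)
open import Data.Nat.Properties using (≤-refl; ≤-trans; m≤n⇒m≤1+n; +-comm)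
open import Data.Fin using (Fin; punchIn; punchOut; fromℕ; inject₁; toℕ; _≟_)
open import Data.Fin.Properties
  using (punchOut-cong; punchOut-injective; punchIn-punchOut; punchIn-injective;
         fromℕ≢inject₁; inject₁-injective; toℕ-inject₁)
open import Data.Product using (_×_; _,_; ∃₂)
open import Relation.Binary.PropositionalEquality
  using (_≡_; _≢_; refl; trans; subst; subst₂) renaming (sym to ≡-sym)
open import Relation.Nullary using (yes; no)
open import Data.Empty using (⊥-elim)

AtMostOneNeighbour : ∀ {n} → Graph n → Fin n → Set
AtMostOneNeighbour G u = ∀ {v w} → Adj G u v → Adj G u w → v ≡ w

IsLeaf⇒AtMostOneNeighbour : ∀ {n} (G : Graph n) (u : Fin n) → IsLeaf G u → AtMostOneNeighbour G u
IsLeaf⇒AtMostOneNeighbour G u (_ , _ , unique) uv uw = trans (unique _ uv) (≡-sym (unique _ uw))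

WalkWithin : ∀ {n} → Graph n → Fin n → Fin n → ℕ → Set
WalkWithin G x y k = ∃₂ λ m (_ : m ≤ k) → Walk G x y m

module _ {n : ℕ} (G : Graph (suc n)) (u : Fin (suc n)) where

  private
    G-u = deleteVertex G u

  punchInWalk : ∀ {i j k} → Walk G-u i j k → Walk G (punchIn u i) (punchIn u j) k
  punchInWalk nil        = nil
  punchInWalk (cons a w) = cons a (punchInWalk w)

  DistGt-deleteVertex : ∀ {i j d} →
    DistGt G (punchIn u i) (punchIn u j) d → DistGt G-u i j d
  DistGt-deleteVertex far k k≤d w = far k k≤d (punchInWalk w)

  punchOutAdj : ∀ {x y} (u≢x : u ≢ x) (u≢y : u ≢ y) →
    Adj G x y → Adj G-u (punchOut u≢x) (punchOut u≢y)
  punchOutAdj u≢x u≢y =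
    subst₂ (Adj G) (≡-sym (punchIn-punchOut u≢x)) (≡-sym (punchIn-punchOut u≢y))

  module _ (lonely : AtMostOneNeighbour G u) where

    punchOutWalk : ∀ {x y k} (u≢x : u ≢ x) (u≢y : u ≢ y) →
      Walk G x y k → WalkWithin G-u (punchOut u≢x) (punchOut u≢y) k
    punchOutWalk u≢x u≢y nil =
      0 , ≤-refl , subst (λ t → Walk G-u (punchOut u≢x) t 0) (punchOut-cong u refl) nil
    punchOutWalk u≢x u≢y (cons {v = v} xv w) with u ≟ v
    ... | no u≢v =
      let m , m≤k , w′ = punchOutWalk u≢v u≢y w
      in suc m , s≤s m≤k , cons (punchOutAdj u≢x u≢v xv) w′
    punchOutWalk u≢x u≢y (cons xu nil) | yes refl = ⊥-elim (u≢y refl)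
    punchOutWalk {x} u≢x u≢y (cons xu (cons {v = z} uz w)) | yes refl =
      let m , m≤k , w′ = punchOutWalk u≢z u≢y w
      in m , m≤n⇒m≤1+n (m≤n⇒m≤1+n m≤k)
           , subst (λ t → Walk G-u t (punchOut u≢y) m) (punchOut-cong u z≡x) w′
      where
      z≡x : z ≡ x
      z≡x = lonely uz (Graph.sym G xu)
      u≢z : u ≢ z
      u≢z u≡z = irrefl G (subst (Adj G u) (≡-sym u≡z) uz)

    DistGt-punchOut : ∀ {x y d} (u≢x : u ≢ x) (u≢y : u ≢ y) →
      DistGt G-u (punchOut u≢x) (punchOut u≢y) d → DistGt G x y d
    DistGt-punchOut u≢x u≢y far k k≤d w =
      let m , m≤k , w′ = punchOutWalk u≢x u≢y w
      in far m (≤-trans m≤k k≤d) w′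

  restrictColouring : ∀ {k} → (Fin (suc n) → Fin k) → Fin n → Fin k
  restrictColouring c i = c (punchIn u i)

  restrictColouring-isPacking : ∀ S {k c} →
    IsPackingColoring S G k c → IsPackingColoring S G-u k (restrictColouring c)
  restrictColouring-isPacking S packing i j i≢j same =
    DistGt-deleteVertex (packing _ _ (λ e → i≢j (punchIn-injective u i j e)) same)

  extendColouring : ∀ {k} → (Fin n → Fin k) → Fin (suc n) → Fin (suc k)
  extendColouring {k} c x with u ≟ x
  ... | yes _   = fromℕ k
  ... | no u≢x = inject₁ (c (punchOut u≢x))

  extendColouring-isPacking : ∀ S {k c} → AtMostOneNeighbour G u →
    IsPackingColoring S G-u k c → IsPackingColoring S G (suc k) (extendColouring c)
  extendColouring-isPacking S {c = c} lonely packing x y x≢y same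
    with u ≟ x | u ≟ y
  ... | yes refl | yes refl = ⊥-elim (x≢y refl)
  ... | yes refl | no _    = ⊥-elim (fromℕ≢inject₁ same)
  ... | no _     | yes refl = ⊥-elim (fromℕ≢inject₁ (≡-sym same))
  ... | no u≢x   | no u≢y   =
    subst (λ t → DistGt G x y (s S t)) (≡-sym (toℕ-inject₁ (c (punchOut u≢x))))
      (DistGt-punchOut lonely u≢x u≢y
        (packing _ _ (λ e → x≢y (punchOut-injective u≢x u≢y e)) (inject₁-injective same)))

mainTheorem2 : (S : PackingSequence) (n : ℕ) (G : Graph (suc n)) (u : Fin (suc n))
    → IsLeaf G u
    → (k k′ : ℕ)
    → IsPackingChromaticNumber S G k
    → IsPackingChromaticNumber S (deleteVertex G u) k′
    → (k ≤ k′ + 1) × (k′ ≤ k)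
mainTheorem2 S n G u leaf k k′ ((c , c-packing) , least) ((c′ , c′-packing) , least′) =
  subst (k ≤_) (+-comm 1 k′) (least (suc k′) (extendColouring G u c′ , extended))
  , least′ k (restrictColouring G u c , restrictColouring-isPacking G u S c-packing)
  where
  extended : IsPackingColoring S G (suc k′) (extendColouring G u c′)
  extended = extendColouring-isPacking G u S (IsLeaf⇒AtMostOneNeighbour G u leaf) c′-packing
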